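{- For any $k$-uniform hypergraph $\mathcal{H}$ on $n$ vertices, there exists a $(k+1)$-uniform hypergraph $\mathcal{H}'$ on $n+2$ vertices satisfying the following two properties: (1) for all $a,b \in \mathbb{Z}_+$, Maker wins the $(a,b)$-game on $\mathcal{H}$ if and only if Maker wins the $(a+1,b+1)$-game on $\mathcal{H}'$; (2) for all $t \in \mathbb{Z}_+$, Maker has a strategy ensuring that she fills an edge during the first $t$ rounds of the $(\ast,\ast)$-game on $\mathcal{H}$ if and only if Maker has a strategy ensuring that she fills an edge during the first $t+1$ rounds of the $(\ast,\ast)$-game on $\mathcal{H}'$.
   Context: A hypergraph $\mathcal{H}$ consists of a finite vertex set $V(\mathcal{H})$ and a set $E(\mathcal{H})$ of subsets of $V(\mathcal{H})$ (edges); it is $k$-uniform if every edge has exactly $k$ vertices. For $a,b$ (nonnegative integers or $\ast$, meaning an unlimited supply, i.e. enough tokens to use a new one on every turn), the $(a,b)$-game on $\mathcal{H}$: Maker has $a$ tokens and Breaker has $b$ tokens; initially the board is empty. Players alternate turns, Maker first. On a turn a player may pass, or place one of their own tokens on an unoccupied vertex, the token being either not yet used or moved from its current vertex on the board (which becomes unoccupied). Maker fills an edge (and wins) as soon as all vertices of some edge carry Maker tokens; Breaker wins if this never happens or if the game reaches the same state twice. The $(\ast,\ast)$-game is the classical Maker–Breaker game in which players alternately claim unclaimed vertices. A round consists of one Maker move followed by one Breaker move. -}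

module Defs where

open import Data.Nat using (ℕ; zero; suc; _<_)
open import Data.Fin using (Fin)
open import Data.Fin.Subset using (Subset; _∈_; ∣_∣)
open import Data.Vec using (Vec; lookup; replicate; _[_]≔_; count)
open import Data.List using (List; []; _∷_; [_])
open import Data.List.Relation.Unary.All using (All)
open import Data.List.Relation.Unary.Any using (Any)
open import Data.List.Membership.Propositional using (_∉_)
open import Data.Product using (Σ; _×_; _,_)
open import Data.Sum using (_⊎_)
open import Data.Empty using (⊥)
open import Data.Unit using (⊤)
open import Relation.Binary.PropositionalEquality using (_≡_)
open import Relation.Nullary using (Dec; yes; no)

record Hypergraph (n : ℕ) : Set where
  constructor hypergraph
  field
    edges : List (Subset n)
open Hypergraph public

Uniform : ∀ {n} → ℕ → Hypergraph n → Set
Uniform k H = All (λ e → ∣ e ∣ ≡ k) (edges H)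

data Tokens : Set where
  fin       : ℕ → Tokens
  unlimited : Tokens

CanUseNew : Tokens → ℕ → Set
CanUseNew (fin a)   m = m < a
CanUseNew unlimited m = ⊤

data Cell : Set where
  empty mk bk : Cell

data Player : Set where
  maker breaker : Player

Board : ℕ → Set
Board n = Vec Cell n

emptyBoard : ∀ {n} → Board n
emptyBoard = replicate _ empty

State : ℕ → Set
State n = Board n × Player

isCell : (c d : Cell) → Dec (c ≡ d)
isCell empty empty = yes _≡_.refl
isCell empty mk = no (λ ())
isCell empty bk = no (λ ())
isCell mk empty = no (λ ())
isCell mk mk = yes _≡_.refl
isCell mk bk = no (λ ())
isCell bk empty = no (λ ())
isCell bk mk = no (λ ())
isCell bk bk = yes _≡_.refl

tokensOn : ∀ {n} → Cell → Board n → ℕ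
tokensOn c B = count (λ d → isCell d c) B

data Step {n : ℕ} (c : Cell) (s : Tokens) (B : Board n) : Board n → Set where
  pass  : Step c s B B
  place : (v : Fin n) → lookup B v ≡ empty → CanUseNew s (tokensOn c B) →
          Step c s B (B [ v ]≔ c)
  move  : (u v : Fin n) → lookup B u ≡ c → lookup B v ≡ empty →
          Step c s B ((B [ u ]≔ empty) [ v ]≔ c)

Fills : ∀ {n} → Hypergraph n → Board n → Set
Fills H B = Any (λ e → ∀ v → v ∈ e → lookup B v ≡ mk) (edges H)

-- MakerWins H a b V B : Maker is to move on board B, V is the list of
-- states visited so far (including the current one).  Maker wins if she
-- has a move that fills an edge, or a move to a new state such that
-- every Breaker reply leads to a new state from which Maker again wins.
-- (Breaker wins on any repetition of a state; since the state space is
-- finite, every play is finite, so the inductive definition captures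
-- exactly the existence of a winning strategy.)

data MakerWins {n : ℕ} (H : Hypergraph n) (a b : Tokens)
     : List (State n) → Board n → Set where
  win : ∀ {V B} (B' : Board n) → Step mk a B B' →
        (Fills H B' ⊎
          (((B' , breaker) ∉ V) ×
           (∀ B'' → Step bk b B' B'' →
              ((B'' , maker) ∉ ((B' , breaker) ∷ V)) ×
              MakerWins H a b ((B'' , maker) ∷ (B' , breaker) ∷ V) B''))) →
        MakerWins H a b V B

MakerWinsGame : ∀ {n} → Hypergraph n → Tokens → Tokens → Set
MakerWinsGame H a b = MakerWins H a b [ (emptyBoard , maker) ] emptyBoard

WinWithin : ∀ {n} → Hypergraph n → Tokens → Tokens →
            ℕ → List (State n) → Board n → Set
WinWithin H a b zero    V B = ⊥
WinWithin H a b (suc t) V B =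
  Σ _ λ B' → Step mk a B B' ×
    (Fills H B' ⊎
      (((B' , breaker) ∉ V) ×
       (∀ B'' → Step bk b B' B'' →
          ((B'' , maker) ∉ ((B' , breaker) ∷ V)) ×
          WinWithin H a b t ((B'' , maker) ∷ (B' , breaker) ∷ V) B'')))

FastWin : ∀ {n} → Hypergraph n → ℕ → Set
FastWin H t = WinWithin H unlimited unlimited t [ (emptyBoard , maker) ] emptyBoard

{-# OPTIONS --safe #-}
-- H′ adds an apex u, lying in every edge, and a vertex v: its edges are u ∪ e for the edges e
-- of H and u ∪ v ∪ S for the (k − 1)-sets S of old vertices.  Maker must open on u, or Breaker
-- takes u for good; Breaker must answer on v, or Maker takes v and then only needs k − 1 old
-- vertices.  After this round the game on H′ is the game on H with one token fewer on each
-- side, which gives the shifts a + 1, b + 1 and t + 1.  If Breaker later moves his token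
-- off v, Maker takes v and claims old vertices until she has k − 1 of them.  Her winning
-- strategy on H guarantees that she can: played against a passing Breaker it needs k tokens
-- and enough rounds, and against a Breaker who places whenever he can, enough free vertices.
module Submission where

open import Defs
open import Data.Empty using (⊥-elim)
open import Data.Fin using (zero; suc)
open import Data.Fin.Subset using (Subset; _∈_; ∣_∣; inside; outside) renaming (⊥ to ∅)
open import Data.Fin.Subset.Properties using (∉⊥; ∣⊥∣≡0)
open import Data.List using (List; []; _∷_; [_]; map; _++_)
open import Data.List.Membership.Propositional using () renaming (_∈_ to _∈ₗ_; _∉_ to _∉ₗ_)
open import Data.List.Membership.Propositional.Properties using (∈-map⁺; ∈-++⁺ˡ; ∈-++⁺ʳ; ∈-++⁻)
open import Data.List.Relation.Unary.All as All using (All; []; _∷_)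
open import Data.List.Relation.Unary.All.Properties using (All¬⇒¬Any) renaming (map⁺ to All-map⁺; ++⁺ to All-++⁺)
open import Data.List.Relation.Unary.Any as Any using (Any; here; there)
open import Data.List.Relation.Unary.Any.Properties using (++⁺ˡ; ++⁺ʳ; ++⁻) renaming (map⁺ to Any-map⁺; map⁻ to Any-map⁻)
open import Data.Nat using (ℕ; zero; suc; pred; _+_; _∸_; _≤_; _<_; z≤n; s≤s; s≤s⁻¹; _<?_; _≤?_)
open import Data.Nat.Properties
open import Algebra.Properties.CommutativeSemigroup +-commutativeSemigroup using (x∙yz≈y∙xz)
open import Data.Product using (Σ; ∃; _×_; _,_; proj₁; proj₂)
open import Data.Sum using (inj₁; inj₂)
open import Data.Unit using (⊤; tt)
open import Data.Vec using ([]; _∷_; lookup; _[_]≔_; here; there)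
open import Data.Vec.Properties using (lookup∘update; lookup∘update′; lookup-replicate)
open import Function using (_∘_; id)
open import Function.Bundles using (_⇔_; mk⇔; Equivalence)
open import Relation.Binary.PropositionalEquality using (_≡_; _≢_; refl; sym; trans; cong; cong₂; subst; module ≡-Reasoning)
open import Relation.Nullary using (¬_; Dec; yes; no)

data Fuel : Set where
  ∞    : Fuel
  fuel : ℕ → Fuel

data _↝_ : Fuel → Fuel → Set where
  tick∞ : ∞ ↝ ∞
  tick  : ∀ {t} → fuel (suc t) ↝ fuel t

↝-functional : ∀ {f f′ f″} → f ↝ f′ → f ↝ f″ → f′ ≡ f″
↝-functional tick∞ tick∞ = refl
↝-functional tick  tick  = refl

Lasts : Fuel → ℕ → Set
Lasts ∞        _ = ⊤
Lasts (fuel t) r = r ≤ t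

spend : ∀ f {r} → Lasts f (suc r) → ∃ λ f′ → f ↝ f′ × Lasts f′ r
spend ∞              _         = ∞ , tick∞ , tt
spend (fuel (suc t)) (s≤s r≤t) = fuel t , tick , r≤t

-- MakerWins and WinWithin in one family: they are Wins with fuel ∞ and fuel t respectively.
module _ {n : ℕ} (H : Hypergraph n) (a b : Tokens) where

  data Wins   : Fuel → List (State n) → Board n → Set
  data Forces : Fuel → List (State n) → Board n → Set

  data Wins where
    win : ∀ {f f′ V B B′} → f ↝ f′ → Step mk a B B′ → Forces f′ V B′ → Wins f V B

  data Forces where
    filled  : ∀ {f V B′} → Fills H B′ → Forces f V B′
    replies : ∀ {f V B′} → (B′ , breaker) ∉ₗ V →
              (∀ {B″} → Step bk b B′ B″ →
                 (B″ , maker) ∉ₗ (B′ , breaker) ∷ V ×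
                 Wins f ((B″ , maker) ∷ (B′ , breaker) ∷ V) B″) →
              Forces f V B′

module _ {n : ℕ} {H : Hypergraph n} {a b : Tokens} where

  makerWins⇔wins : ∀ {V B} → MakerWins H a b V B ⇔ Wins H a b ∞ V B
  makerWins⇔wins = mk⇔ to from
    where
    to : ∀ {V B} → MakerWins H a b V B → Wins H a b ∞ V B
    to (win _ st (inj₁ fl))          = win tick∞ st (filled fl)
    to (win _ st (inj₂ (nr , next))) =
      win tick∞ st (replies nr λ st′ → proj₁ (next _ st′) , to (proj₂ (next _ st′)))

    from : ∀ {V B} → Wins H a b ∞ V B → MakerWins H a b V B
    from (win tick∞ st (filled fl))        = win _ st (inj₁ fl)
    from (win tick∞ st (replies nr next)) =
      win _ st (inj₂ (nr , λ _ st′ → proj₁ (next st′) , from (proj₂ (next st′))))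

  winWithin⇔wins : ∀ t {V B} → WinWithin H a b t V B ⇔ Wins H a b (fuel t) V B
  winWithin⇔wins t = mk⇔ (to t) (from t)
    where
    to : ∀ t {V B} → WinWithin H a b t V B → Wins H a b (fuel t) V B
    to (suc t) (_ , st , inj₁ fl)          = win tick st (filled fl)
    to (suc t) (_ , st , inj₂ (nr , next)) =
      win tick st (replies nr λ st′ → proj₁ (next _ st′) , to t (proj₂ (next _ st′)))

    from : ∀ t {V B} → Wins H a b (fuel t) V B → WinWithin H a b t V B
    from zero    (win () _ _)
    from (suc t) (win tick st (filled fl))        = _ , st , inj₁ fl
    from (suc t) (win tick st (replies nr next)) =
      _ , st , inj₂ (nr , λ _ st′ → proj₁ (next st′) , from t (proj₂ (next st′)))

Within : Tokens → ℕ → Set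
Within (fin c)   m = m ≤ c
Within unlimited _ = ⊤

spare : Tokens → ℕ → Tokens
spare (fin c)   m = fin (c ∸ m)
spare unlimited _ = unlimited

1+_ : Tokens → Tokens
1+ fin c     = fin (suc c)
1+ unlimited = unlimited

within-0 : ∀ s {m} → m ≡ 0 → Within s m
within-0 (fin c)   refl = z≤n
within-0 unlimited _    = tt

within⇒canUseNew : ∀ s {m m′} → Within s m′ → m < m′ → CanUseNew s m
within⇒canUseNew (fin c)   m′≤c m<m′ = <-≤-trans m<m′ m′≤c
within⇒canUseNew unlimited _    _    = tt

within-≤ : ∀ s {m m′} → m ≤ m′ → Within s m′ → Within s m
within-≤ (fin c)   m≤m′ m′≤c = ≤-trans m≤m′ m′≤c
within-≤ unlimited _    _    = tt

canUseNew? : ∀ s m → Dec (CanUseNew s m)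
canUseNew? (fin c)   m = m <? c
canUseNew? unlimited _ = yes tt

canUseNew-1+ : ∀ s {m} → CanUseNew s m → CanUseNew (1+ s) (suc m)
canUseNew-1+ (fin c)   = s≤s
canUseNew-1+ unlimited = id

canUseNew-1+⁻ : ∀ s {m} → CanUseNew (1+ s) (suc m) → CanUseNew s m
canUseNew-1+⁻ (fin c)   = s≤s⁻¹
canUseNew-1+⁻ unlimited = id

canUseNew-1+-0 : ∀ s {m} → m ≡ 0 → CanUseNew (1+ s) m
canUseNew-1+-0 (fin c)   refl = s≤s z≤n
canUseNew-1+-0 unlimited _    = tt

spare-1+ : ∀ s m → spare (1+ s) (suc m) ≡ spare s m
spare-1+ (fin c)   m = refl
spare-1+ unlimited m = refl

#mk #bk #free : ∀ {n} → Board n → ℕ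
#mk   = tokensOn mk
#bk   = tokensOn bk
#free = tokensOn empty

tally : Cell → Cell → ℕ
tally x c = tokensOn c (x ∷ [])

tokensOn-∷ : ∀ {n} x c (Z : Board n) → tokensOn c (x ∷ Z) ≡ tally x c + tokensOn c Z
tokensOn-∷ x c Z with isCell x c
... | yes _ = refl
... | no _  = refl

tokensOn-[]≔ : ∀ {n} (Z : Board n) i {x} y c → lookup Z i ≡ x →
               tally x c + tokensOn c (Z [ i ]≔ y) ≡ tally y c + tokensOn c Z
tokensOn-[]≔ (z ∷ Z) zero y c refl = begin
  tally z c + tokensOn c (y ∷ Z)          ≡⟨ cong (tally z c +_) (tokensOn-∷ y c Z) ⟩
  tally z c + (tally y c + tokensOn c Z)  ≡⟨ x∙yz≈y∙xz (tally z c) (tally y c) _ ⟩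
  tally y c + (tally z c + tokensOn c Z)  ≡⟨ cong (tally y c +_) (tokensOn-∷ z c Z) ⟨
  tally y c + tokensOn c (z ∷ Z)          ∎
  where open ≡-Reasoning
tokensOn-[]≔ (z ∷ Z) (suc i) y c p with isCell z c
... | yes _ = trans (+-suc _ _) (trans (cong suc (tokensOn-[]≔ Z i y c p)) (sym (+-suc _ _)))
... | no _  = tokensOn-[]≔ Z i y c p

[]≔-keeps : ∀ {n} (Z : Board n) u v {x} → lookup Z v ≡ x → lookup (Z [ u ]≔ x) v ≡ x
[]≔-keeps (_ ∷ _) zero    zero    _ = refl
[]≔-keeps (_ ∷ _) zero    (suc v) p = p
[]≔-keeps (_ ∷ _) (suc u) zero    p = p
[]≔-keeps (_ ∷ Z) (suc u) (suc v) p = []≔-keeps Z u v p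

[]≔-elsewhere : ∀ {n} (Z : Board n) {u v x} y → lookup Z v ≡ x → lookup Z u ≢ x →
                lookup (Z [ u ]≔ y) v ≡ x
[]≔-elsewhere Z y p q = trans (lookup∘update′ (λ { refl → q p }) Z y) p

≡-≢ : ∀ {A : Set} {x y z : A} → x ≡ y → y ≢ z → x ≢ z
≡-≢ x≡y y≢z x≡z = y≢z (trans (sym x≡y) x≡z)

tokensOn-move : ∀ {n} (Z : Board n) {u v x} c → lookup Z u ≡ x → lookup Z v ≡ empty →
                tokensOn c ((Z [ u ]≔ empty) [ v ]≔ x) ≡ tokensOn c Z
tokensOn-move Z {u} {v} {x} c p q = +-cancelˡ-≡ (tally empty c) _ _ (begin
  tally empty c + tokensOn c ((Z [ u ]≔ empty) [ v ]≔ x)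
    ≡⟨ tokensOn-[]≔ (Z [ u ]≔ empty) v x c ([]≔-keeps Z u v q) ⟩
  tally x c + tokensOn c (Z [ u ]≔ empty)
    ≡⟨ tokensOn-[]≔ Z u empty c p ⟩
  tally empty c + tokensOn c Z ∎)
  where open ≡-Reasoning

data Rivals : Cell → Cell → Set where
  maker-breaker : Rivals mk bk
  breaker-maker : Rivals bk mk

placed-counts : ∀ {n c o} → Rivals c o → ∀ (Z : Board n) i → lookup Z i ≡ empty →
                tokensOn o (Z [ i ]≔ c) ≡ tokensOn o Z ×
                tokensOn c (Z [ i ]≔ c) ≡ suc (tokensOn c Z) ×
                suc (#free (Z [ i ]≔ c)) ≡ #free Z
placed-counts maker-breaker Z i p =
  tokensOn-[]≔ Z i mk bk p , tokensOn-[]≔ Z i mk mk p , tokensOn-[]≔ Z i mk empty p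
placed-counts breaker-maker Z i p =
  tokensOn-[]≔ Z i bk mk p , tokensOn-[]≔ Z i bk bk p , tokensOn-[]≔ Z i bk empty p

data Growth {n} (s : Tokens) (c : Cell) (Z Z′ : Board n) : Set where
  same  : tokensOn c Z′ ≡ tokensOn c Z → #free Z′ ≡ #free Z → Growth s c Z Z′
  added : tokensOn c Z′ ≡ suc (tokensOn c Z) → suc (#free Z′) ≡ #free Z →
          CanUseNew s (tokensOn c Z) → Growth s c Z Z′

step-counts : ∀ {n c o s} {Z Z′ : Board n} → Rivals c o → Step c s Z Z′ →
              tokensOn o Z′ ≡ tokensOn o Z × Growth s c Z Z′
step-counts _ pass = refl , same refl refl
step-counts {Z = Z} r (place i p can) =
  let o= , c= , free= = placed-counts r Z i p in o= , added c= free= can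
step-counts {Z = Z} _ (move u v p q) =
  tokensOn-move Z _ p q , same (tokensOn-move Z _ p q) (tokensOn-move Z _ p q)

maker-step-≤ : ∀ {n s} {Z Z′ : Board n} → Step mk s Z Z′ → #mk Z′ ≤ suc (#mk Z)
maker-step-≤ st with step-counts maker-breaker st
... | _ , same  mk= _   = ≤-trans (≤-reflexive mk=) (n≤1+n _)
... | _ , added mk= _ _ = ≤-reflexive mk=

within-step : ∀ {n} s {Z Z′ : Board n} → Step mk s Z Z′ → Within s (#mk Z) → Within s (#mk Z′)
within-step s st ok with step-counts maker-breaker st
... | _ , same mk= _ = subst (Within s) (sym mk=) ok
within-step (fin c)   st ok | _ , added mk= _ can = subst (_≤ c) (sym mk=) can
within-step unlimited st ok | _ , added _ _ _     = tt

tokensOn-emptyBoard : ∀ n {c o} → Rivals c o → tokensOn c (emptyBoard {n}) ≡ 0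
tokensOn-emptyBoard zero    _             = refl
tokensOn-emptyBoard (suc n) maker-breaker = tokensOn-emptyBoard n maker-breaker
tokensOn-emptyBoard (suc n) breaker-maker = tokensOn-emptyBoard n breaker-maker

cell-of : ∀ {n} (Z : Board n) c → 0 < tokensOn c Z → ∃ λ i → lookup Z i ≡ c
cell-of (x ∷ Z) c pos with isCell x c
... | yes x≡c = zero , x≡c
... | no _    = let i , p = cell-of Z c pos in suc i , p

maker-keeps-bk : ∀ {n s} {B B′ : Board n} i → Step mk s B B′ → lookup B i ≡ bk → lookup B′ i ≡ bk
maker-keeps-bk i pass held = held
maker-keeps-bk {B = B} i (place u p _) held = []≔-elsewhere B mk held (≡-≢ p λ ())
maker-keeps-bk {B = B} i (move u v p q) held =
  []≔-elsewhere (B [ u ]≔ empty) mk ([]≔-elsewhere B empty held (≡-≢ p λ ()))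
                (≡-≢ ([]≔-keeps B u v q) λ ())

step-∷ : ∀ {n c s s′ x} {X X′ : Board n} →
         (∀ {m} → CanUseNew s m → CanUseNew s′ (tally x c + m)) →
         Step c s X X′ → Step c s′ (x ∷ X) (x ∷ X′)
step-∷ _ pass = pass
step-∷ {c = c} {s′ = s′} {x} {X} can′ (place i p can) =
  place (suc i) p (subst (CanUseNew s′) (sym (tokensOn-∷ x c X)) (can′ can))
step-∷ _ (move u v p q) = move (suc u) (suc v) p q

-- The augmented hypergraph

Claimed : ∀ {n} → Board n → Subset n → Set
Claimed B e = ∀ v → v ∈ e → lookup B v ≡ mk

claimed-size : ∀ {n} (B : Board n) {e} → Claimed B e → ∣ e ∣ ≤ #mk B
claimed-size []      {[]}          _ = z≤n
claimed-size (x ∷ B) {inside ∷ e}  h with h zero here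
... | refl = s≤s (claimed-size B λ v p → h (suc v) (there p))
claimed-size (x ∷ B) {outside ∷ e} h = begin
  ∣ e ∣                  ≤⟨ claimed-size B (λ v p → h (suc v) (there p)) ⟩
  #mk B                  ≤⟨ m≤n+m (#mk B) (tally x mk) ⟩
  tally x mk + #mk B     ≡⟨ tokensOn-∷ x mk B ⟨
  #mk (x ∷ B)            ∎
  where open ≤-Reasoning

fills-size : ∀ {n k} {H : Hypergraph n} → Uniform k H → ∀ B → Fills H B → k ≤ #mk B
fills-size {k = k} uni B fl =
  All.lookupWith {R = λ _ → k ≤ #mk B} (λ size h → subst (_≤ #mk B) size (claimed-size B h)) uni fl

unclaimed-blocks : ∀ {n} (B : Board n) {es} i → All (i ∈_) es → lookup B i ≢ mk → ¬ Any (Claimed B) es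
unclaimed-blocks B i i∈es i-free fl =
  i-free (All.lookupWith {R = λ _ → lookup B i ≡ mk} (λ i∈e h → h i i∈e) i∈es fl)

∈⇒0<∣∣ : ∀ {n} {p : Subset n} {x} → x ∈ p → 0 < ∣ p ∣
∈⇒0<∣∣ {p = inside ∷ _}  _           = s≤s z≤n
∈⇒0<∣∣ {p = outside ∷ _} (there x∈p) = ∈⇒0<∣∣ x∈p

fills-0-uniform : ∀ {n} {H : Hypergraph n} → Uniform 0 H → ∀ B B′ → Fills H B → Fills H B′
fills-0-uniform uni B B′ = go uni
  where
  go : ∀ {es} → All (λ e → ∣ e ∣ ≡ 0) es → Any (Claimed B) es → Any (Claimed B′) es
  go (size ∷ _)  (here _)   = here λ _ v∈e → ⊥-elim (<-irrefl (sym size) (∈⇒0<∣∣ v∈e))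
  go (_ ∷ sizes) (there fl) = there (go sizes fl)

subsetsOfSize : ∀ n → ℕ → List (Subset n)
subsetsOfSize zero    zero    = [ [] ]
subsetsOfSize zero    (suc m) = []
subsetsOfSize (suc n) zero    = map (outside ∷_) (subsetsOfSize n zero)
subsetsOfSize (suc n) (suc m) =
  map (outside ∷_) (subsetsOfSize n (suc m)) ++ map (inside ∷_) (subsetsOfSize n m)

subsetsOfSize-size : ∀ n m → All (λ S → ∣ S ∣ ≡ m) (subsetsOfSize n m)
subsetsOfSize-size zero    zero    = refl ∷ []
subsetsOfSize-size zero    (suc m) = []
subsetsOfSize-size (suc n) zero    = All-map⁺ (subsetsOfSize-size n zero)
subsetsOfSize-size (suc n) (suc m) =
  All-++⁺ (All-map⁺ (subsetsOfSize-size n (suc m))) (All-map⁺ (All.map (cong suc) (subsetsOfSize-size n m)))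

∈-subsetsOfSize : ∀ {n} (S : Subset n) → S ∈ₗ subsetsOfSize n ∣ S ∣
∈-subsetsOfSize []            = here refl
∈-subsetsOfSize (inside ∷ S)  = ∈-++⁺ʳ _ (∈-map⁺ (inside ∷_) (∈-subsetsOfSize S))
∈-subsetsOfSize (outside ∷ S) with ∣ S ∣ | ∈-subsetsOfSize S
... | zero  | S∈ = ∈-map⁺ (outside ∷_) S∈
... | suc _ | S∈ = ∈-++⁺ˡ (∈-map⁺ (outside ∷_) S∈)

claimed-subset : ∀ {n} (Z : Board n) m → m ≤ #mk Z → ∃ λ S → ∣ S ∣ ≡ m × Claimed Z S
claimed-subset {n} Z zero _ = ∅ , ∣⊥∣≡0 n , λ _ v∈∅ → ⊥-elim (∉⊥ v∈∅)
claimed-subset (x ∷ Z) (suc m) m≤ with isCell x mk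
... | yes refl = let S , size , h = claimed-subset Z m (s≤s⁻¹ m≤) in
  inside ∷ S , cong suc size , λ { zero here → refl ; (suc v) (there p) → h v p }
... | no _     = let S , size , h = claimed-subset Z (suc m) m≤ in
  outside ∷ S , size , λ { (suc v) (there p) → h v p }

apexEdges : ∀ {n} → Hypergraph n → List (Subset (suc (suc n)))
apexEdges H = map (λ e → inside ∷ outside ∷ e) (edges H)

pairEdges : ∀ n → ℕ → List (Subset (suc (suc n)))
pairEdges n zero    = []
pairEdges n (suc k) = map (λ S → inside ∷ inside ∷ S) (subsetsOfSize n k)

-- Vertex 0 is the apex u and vertex 1 is v.
augment : ∀ {n} → ℕ → Hypergraph n → Hypergraph (suc (suc n))
augment {n} k H = hypergraph (apexEdges H ++ pairEdges n k)

augment-uniform : ∀ {n k} {H : Hypergraph n} → Uniform k H → Uniform (suc k) (augment k H)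
augment-uniform {n} {k} uni = All-++⁺ (All-map⁺ (All.map (cong suc) uni)) (pairs k)
  where
  pairs : ∀ k → All (λ e → ∣ e ∣ ≡ suc k) (pairEdges n k)
  pairs zero    = []
  pairs (suc k) = All-map⁺ (All.map (cong (2 +_)) (subsetsOfSize-size n k))

apex∈augment : ∀ {n} k (H : Hypergraph n) → All (zero ∈_) (edges (augment k H))
apex∈augment {n} k H = All-++⁺ (All-map⁺ (All.universal (λ _ → here) (edges H))) (pairs k)
  where
  pairs : ∀ k → All (zero ∈_) (pairEdges n k)
  pairs zero    = []
  pairs (suc k) = All-map⁺ (All.universal (λ _ → here) (subsetsOfSize n k))

v∈pairEdges : ∀ n k → All (suc zero ∈_) (pairEdges n k)
v∈pairEdges n zero    = []
v∈pairEdges n (suc k) = All-map⁺ (All.universal (λ _ → there here) (subsetsOfSize n k))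

fills-augment : ∀ {n k} {H : Hypergraph n} {X} y → Fills H X → Fills (augment k H) (mk ∷ y ∷ X)
fills-augment {X = X} y fl = ++⁺ˡ (Any-map⁺ (Any.map lift fl))
  where
  lift : ∀ {e} → Claimed X e → Claimed (mk ∷ y ∷ X) (inside ∷ outside ∷ e)
  lift h zero          here               = refl
  lift h (suc (suc v)) (there (there v∈e)) = h v v∈e

fills-augment⁻ : ∀ {n} k {H : Hypergraph n} {X y} → y ≢ mk → Fills (augment k H) (mk ∷ y ∷ X) → Fills H X
fills-augment⁻ {n} k {H} {X} {y} y≢mk fl with ++⁻ (apexEdges H) fl
... | inj₁ apex = Any.map (λ h v v∈e → h (suc (suc v)) (there (there v∈e))) (Any-map⁻ apex)
... | inj₂ pair = ⊥-elim (unclaimed-blocks (mk ∷ y ∷ X) (suc zero) (v∈pairEdges n k) y≢mk pair)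

fills-augment-pair : ∀ {n k} (H : Hypergraph n) (Z : Board n) → k ≤ #mk Z →
                     Fills (augment (suc k) H) (mk ∷ mk ∷ Z)
fills-augment-pair {n} {k} H Z k≤ with claimed-subset Z k k≤
... | S , refl , claimed = ++⁺ʳ (apexEdges H) (Any-map⁺ (Any.map (λ { refl → lift }) (∈-subsetsOfSize S)))
  where
  lift : Claimed (mk ∷ mk ∷ Z) (inside ∷ inside ∷ S)
  lift zero          here                = refl
  lift (suc zero)    (there here)        = refl
  lift (suc (suc v)) (there (there v∈S)) = claimed v v∈S

m∸n≤1+m∸1+n : ∀ m n → m ∸ n ≤ suc (m ∸ suc n)
m∸n≤1+m∸1+n zero    zero    = z≤n
m∸n≤1+m∸1+n (suc m) zero    = ≤-refl
m∸n≤1+m∸1+n zero    (suc n) = z≤n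
m∸n≤1+m∸1+n (suc m) (suc n) = m∸n≤1+m∸1+n m n

module _ {n : ℕ} {H : Hypergraph n} {a b : Tokens} where

  fills-along-passes : (P : Board n → Set) → (∀ {B B′} → Step mk a B B′ → P B → P B′) →
                       ∀ {f V B} → Wins H a b f V B → P B → ∃ λ B′ → Fills H B′ × P B′
  fills-along-passes P keep (win _ st (filled fl))       p = _ , fl , keep st p
  fills-along-passes P keep (win _ st (replies _ next)) p =
    fills-along-passes P keep (proj₂ (next pass)) (keep st p)

  blocked : ∀ {f V B} i → All (i ∈_) (edges H) → lookup B i ≡ bk → ¬ Wins H a b f V B
  blocked i i∈edges held w =
    let B′ , fl , held′ = fills-along-passes (λ B → lookup B i ≡ bk) (maker-keeps-bk i) w held
    in unclaimed-blocks B′ i i∈edges (≡-≢ held′ λ ()) fl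

  wins⇒within : ∀ {k f V B} → Uniform k H → Wins H a b f V B → Within a (#mk B) → Within a k
  wins⇒within uni w ok =
    let B′ , fl , ok′ = fills-along-passes (Within a ∘ #mk) (within-step a) w ok
    in within-≤ a (fills-size uni B′ fl) ok′

  wins⇒lasts : ∀ {k f V B} → Uniform k H → Wins H a b f V B → Lasts f (suc (k ∸ suc (#mk B)))
  wins⇒lasts uni (win tick∞ _ _) = tt
  wins⇒lasts {k} uni (win {B′ = B′} tick st (filled fl)) =
    s≤s (≤-trans (≤-reflexive (m≤n⇒m∸n≡0 (≤-trans (fills-size uni B′ fl) (maker-step-≤ st)))) z≤n)
  wins⇒lasts {k} {B = B} uni (win {B′ = B′} (tick {t}) st (replies _ next)) = s≤s (begin
    k ∸ suc (#mk B)        ≤⟨ ∸-monoʳ-≤ k (maker-step-≤ st) ⟩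
    k ∸ #mk B′             ≤⟨ m∸n≤1+m∸1+n k (#mk B′) ⟩
    suc (k ∸ suc (#mk B′)) ≤⟨ wins⇒lasts uni (proj₂ (next pass)) ⟩
    t                      ∎)
    where open ≤-Reasoning

-- roomM r c (roomB r c): how many free vertices Maker needs to claim r more of them, one
-- per round, when she (Breaker) is to move and Breaker can still bring c new tokens.
roomM roomB : ℕ → Tokens → ℕ
roomM zero    c = zero
roomM (suc r) c = suc (roomB r c)
roomB zero    c             = zero
roomB (suc r) (fin zero)    = roomM (suc r) (fin zero)
roomB (suc r) (fin (suc c)) = suc (roomM (suc r) (fin c))
roomB (suc r) unlimited     = suc (roomM (suc r) unlimited)

roomM-suc : ∀ r c → roomM r (fin (suc c)) ≤ suc (roomM r (fin c))
roomB-suc : ∀ r c → roomB r (fin (suc c)) ≤ suc (roomB r (fin c))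
roomM-suc zero    c       = z≤n
roomM-suc (suc r) c       = s≤s (roomB-suc r c)
roomB-suc zero    c       = z≤n
roomB-suc (suc r) zero    = ≤-refl
roomB-suc (suc r) (suc c) = s≤s (roomM-suc (suc r) c)

roomM≤roomB : ∀ r c → roomM r c ≤ roomB r c
roomM≤roomB zero    c             = z≤n
roomM≤roomB (suc r) (fin zero)    = ≤-refl
roomM≤roomB (suc r) (fin (suc c)) = s≤s (roomB-suc r c)
roomM≤roomB (suc r) unlimited     = n≤1+n _

roomB-spend : ∀ s {r m} → CanUseNew s m → roomB (suc r) (spare s m) ≡ suc (roomM (suc r) (spare s (suc m)))
roomB-spend (fin (suc c)) (s≤s m≤c) rewrite +-∸-assoc 1 m≤c = refl
roomB-spend unlimited     _         = refl

roomB-exhausted : ∀ s {r m} → ¬ CanUseNew s m → roomB (suc r) (spare s m) ≡ roomM (suc r) (spare s m)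
roomB-exhausted (fin c)   cannot rewrite m≤n⇒m∸n≡0 (≮⇒≥ cannot) = refl
roomB-exhausted unlimited cannot = ⊥-elim (cannot tt)

roomB-reserve : ∀ r s → roomB r (spare (1+ s) 0) ≤ roomM (suc r) (spare s 0)
roomB-reserve r (fin c)   = roomB-suc r c
roomB-reserve r unlimited = n≤1+n _

roomM≤1+roomB : ∀ k m c → roomM (k ∸ m) c ≤ suc (roomB (k ∸ suc m) c)
roomM≤1+roomB zero    zero    c = z≤n
roomM≤1+roomB zero    (suc m) c = z≤n
roomM≤1+roomB (suc k) zero    c = ≤-refl
roomM≤1+roomB (suc k) (suc m) c = roomM≤1+roomB k m c

roomM⇒roomB : ∀ k m c {t} → roomM (suc k ∸ m) c ≤ suc t → roomB (k ∸ m) c ≤ t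
roomM⇒roomB k       zero    c room = s≤s⁻¹ room
roomM⇒roomB zero    (suc m) c _    = z≤n
roomM⇒roomB (suc k) (suc m) c room = roomM⇒roomB k m c room

module _ {n : ℕ} (k : ℕ) (b : Tokens) where

  RoomM RoomB : Board n → Set
  RoomM Z = roomM (k ∸ #mk Z) (spare b (#bk Z)) ≤ #free Z
  RoomB Z = roomB (k ∸ #mk Z) (spare b (#bk Z)) ≤ #free Z

  roomB⇒roomM : ∀ {a} {Z Z′ : Board n} → Step mk a Z Z′ → RoomB Z′ → RoomM Z
  roomB⇒roomM {Z = Z} {Z′} st room with step-counts maker-breaker st
  ... | bk= , same mk= free= rewrite sym bk= | sym mk= | sym free= = ≤-trans (roomM≤roomB _ _) room
  ... | bk= , added mk= free= _ = begin
    roomM (k ∸ #mk Z) (spare b (#bk Z))             ≤⟨ roomM≤1+roomB k (#mk Z) _ ⟩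
    suc (roomB (k ∸ suc (#mk Z)) (spare b (#bk Z))) ≡⟨ cong₂ (λ m m′ → suc (roomB (k ∸ m) (spare b m′))) mk= bk= ⟨
    suc (roomB (k ∸ #mk Z′) (spare b (#bk Z′)))     ≤⟨ s≤s room ⟩
    suc (#free Z′)                                  ≡⟨ free= ⟩
    #free Z                                         ∎
    where open ≤-Reasoning

greedy-reply : ∀ {n} s (Z : Board n) r →
               ∃ λ Z″ → Step bk s Z Z″ × #mk Z″ ≡ #mk Z ×
                        (roomM r (spare s (#bk Z″)) ≤ #free Z″ → roomB r (spare s (#bk Z)) ≤ #free Z)
greedy-reply s Z zero = Z , pass , refl , λ _ → z≤n
greedy-reply s Z (suc r) with canUseNew? s (#bk Z) | 1 ≤? #free Z
... | no cannot | _ = Z , pass , refl , subst (_≤ #free Z) (sym (roomB-exhausted s cannot))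
... | yes _   | no full = Z , pass , refl , λ room → ⊥-elim (full (≤-trans (s≤s z≤n) room))
... | yes can | yes free =
  let i , p = cell-of Z empty free
      mk= , bk= , free= = placed-counts breaker-maker Z i p
      Z″ = Z [ i ]≔ bk
  in Z″ , place i p can , mk= , λ room → begin
    roomB (suc r) (spare s (#bk Z))             ≡⟨ roomB-spend s can ⟩
    suc (roomM (suc r) (spare s (suc (#bk Z)))) ≡⟨ cong (λ m → suc (roomM (suc r) (spare s m))) bk= ⟨
    suc (roomM (suc r) (spare s (#bk Z″)))      ≤⟨ s≤s room ⟩
    suc (#free Z″)                              ≡⟨ free= ⟩
    #free Z                                     ∎
  where open ≤-Reasoning

-- Breaker placing a new token whenever he can uses up free vertices fastest.
wins⇒room : ∀ {n k} {H : Hypergraph n} {a b f V Z} → Uniform k H → Wins H a b f V Z → RoomM k b Z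
wins⇒room {k = k} {b = b} uni (win {B′ = B′} _ st (filled fl)) =
  roomB⇒roomM k b st (subst (λ r → roomB r (spare b (#bk B′)) ≤ #free B′)
                            (sym (m≤n⇒m∸n≡0 (fills-size uni B′ fl))) z≤n)
wins⇒room {k = k} {b = b} uni (win {B′ = B′} _ st (replies _ next)) =
  let Z″ , st′ , mk= , back = greedy-reply b B′ (k ∸ #mk B′)
  in roomB⇒roomM k b st (back (subst (λ m → roomM (k ∸ m) (spare b (#bk Z″)) ≤ #free Z″) mk=
                                     (wins⇒room uni (proj₂ (next st′)))))

roomB-breaker-step : ∀ {n s r} {Z Z″ : Board n} → Step bk s Z Z″ →
                     roomB (suc r) (spare s (#bk Z)) ≤ #free Z → roomM (suc r) (spare s (#bk Z″)) ≤ #free Z″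
roomB-breaker-step {s = s} {r} {Z} {Z″} st room with step-counts breaker-maker st
... | _ , same bk= free= rewrite bk= | free= = ≤-trans (roomM≤roomB (suc r) _) room
... | _ , added bk= free= can = s≤s⁻¹ (begin
  suc (roomM (suc r) (spare s (#bk Z″)))      ≡⟨ cong (λ m → suc (roomM (suc r) (spare s m))) bk= ⟩
  suc (roomM (suc r) (spare s (suc (#bk Z)))) ≡⟨ roomB-spend s can ⟨
  roomB (suc r) (spare s (#bk Z))             ≤⟨ room ⟩
  #free Z                                     ≡⟨ free= ⟨
  suc (#free Z″)                              ∎)
  where open ≤-Reasoning

embedState : ∀ {n} → State n → State (suc (suc n))
embedState (X , p) = mk ∷ bk ∷ X , p

-- A history of H, played on H′ with Maker on u and Breaker on v, after the opening round.
embed : ∀ {n} → List (State n) → List (State (suc (suc n)))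
embed V = map embedState V ++ (mk ∷ empty ∷ emptyBoard , breaker) ∷ (emptyBoard , maker) ∷ []

lift-maker : ∀ {n} a {X X′ : Board n} → Step mk a X X′ → Step mk (1+ a) (mk ∷ bk ∷ X) (mk ∷ bk ∷ X′)
lift-maker a = step-∷ (canUseNew-1+ a) ∘ step-∷ id

lift-breaker : ∀ {n} b {X X′ : Board n} → Step bk b X X′ → Step bk (1+ b) (mk ∷ bk ∷ X) (mk ∷ bk ∷ X′)
lift-breaker b = step-∷ id ∘ step-∷ (canUseNew-1+ b)

embed-∈ : ∀ {n} {V : List (State n)} {s} → s ∈ₗ V → embedState s ∈ₗ embed V
embed-∈ = ∈-++⁺ˡ ∘ ∈-map⁺ embedState

embed-∈⁻ : ∀ {n} {V : List (State n)} {X p} → (mk ∷ bk ∷ X , p) ∈ₗ embed V → (X , p) ∈ₗ V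
embed-∈⁻ {V = V} s∈ with ∈-++⁻ (map embedState V) s∈
... | inj₁ s∈V               = Any.map (λ { refl → refl }) (Any-map⁻ s∈V)
... | inj₂ (here ())
... | inj₂ (there (here ()))
... | inj₂ (there (there ()))

-- From H′ to H

data SimulatedMove {n} (a : Tokens) (X : Board n) : Board (suc (suc n)) → Set where
  lifted     : ∀ {X′} → Step mk a X X′ → SimulatedMove a X (mk ∷ bk ∷ X′)
  leavesApex : ∀ j → SimulatedMove a X (empty ∷ bk ∷ (X [ j ]≔ mk))

simulatedMove : ∀ {n} a {X : Board n} {B′} → Step mk (1+ a) (mk ∷ bk ∷ X) B′ → SimulatedMove a X B′
simulatedMove a pass                                   = lifted pass
simulatedMove a (place zero () _)
simulatedMove a (place (suc zero) () _)
simulatedMove a (place (suc (suc i)) p can)            = lifted (place i p (canUseNew-1+⁻ a can))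
simulatedMove a (move zero zero _ ())
simulatedMove a (move zero (suc zero) _ ())
simulatedMove a (move zero (suc (suc j)) _ _)          = leavesApex j
simulatedMove a (move (suc zero) _ () _)
simulatedMove a (move (suc (suc i)) zero _ ())
simulatedMove a (move (suc (suc i)) (suc zero) _ ())
simulatedMove a (move (suc (suc i)) (suc (suc j)) p q) = lifted (move i j p q)

data OpeningMove {n} : Board (suc (suc n)) → Set where
  atApex    : OpeningMove (mk ∷ empty ∷ emptyBoard)
  elsewhere : ∀ {B} → lookup B zero ≡ empty → #bk B ≡ 0 → OpeningMove B

openingMove : ∀ {n s} {B′ : Board (suc (suc n))} → Step mk s emptyBoard B′ → OpeningMove B′
openingMove {n} pass                      = elsewhere refl (tokensOn-emptyBoard (suc (suc n)) breaker-maker)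
openingMove     (place zero _ _)          = atApex
openingMove {n} st@(place (suc _) _ _)    =
  elsewhere refl (trans (proj₁ (step-counts maker-breaker st)) (tokensOn-emptyBoard (suc (suc n)) breaker-maker))
openingMove     (move u _ held _)         = ⊥-elim (≡-≢ (lookup-replicate u empty) (λ ()) held)

module _ {n : ℕ} (k : ℕ) (H : Hypergraph n) (a b : Tokens) where

  private
    H′ = augment k H

  unsimulate : ∀ {f V X} → Wins H′ (1+ a) (1+ b) f (embed V) (mk ∷ bk ∷ X) → Wins H a b f V X
  unsimulate (win t st forces) with simulatedMove a st | forces
  ... | lifted st′ | filled fl = win t st′ (filled (fills-augment⁻ k (λ ()) fl))
  ... | lifted st′ | replies fresh next = win t st′ (replies (fresh ∘ embed-∈) λ st″ →
    proj₁ (next (lift-breaker b st″)) ∘ embed-∈ , unsimulate (proj₂ (next (lift-breaker b st″))))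
  ... | leavesApex j | filled fl =
    ⊥-elim (unclaimed-blocks (empty ∷ bk ∷ _) zero (apex∈augment k H) (λ ()) fl)
  ... | leavesApex j | replies _ next =
    ⊥-elim (blocked zero (apex∈augment k H) refl (proj₂ (next (move (suc zero) zero refl refl))))

  augment-wins⁻ : ∀ {f₁ f₀ f₀′} → f₁ ↝ f₀ → f₀ ↝ f₀′ →
                  Wins H′ (1+ a) (1+ b) f₁ [ (emptyBoard , maker) ] emptyBoard →
                  Wins H a b f₀ [ (emptyBoard , maker) ] emptyBoard
  augment-wins⁻ t₁ t₀ (win {B′ = B′} t st forces) with openingMove st | forces
  ... | atApex | filled fl = win t₀ pass (filled (fills-augment⁻ k (λ ()) fl))
  ... | atApex | replies _ next =
    subst (λ f → Wins H a b f _ _) (↝-functional t t₁)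
      (unsimulate (proj₂ (next (place (suc zero) refl (canUseNew-1+-0 b (tokensOn-emptyBoard n breaker-maker))))))
  ... | elsewhere free _ | filled fl =
    ⊥-elim (unclaimed-blocks B′ zero (apex∈augment k H) (≡-≢ free λ ()) fl)
  ... | elsewhere free no-bk | replies _ next =
    ⊥-elim (blocked zero (apex∈augment k H) (lookup∘update zero B′ bk)
                    (proj₂ (next (place zero free (canUseNew-1+-0 b no-bk)))))

-- From H to H′

data SimulatedReply {n} (b : Tokens) (X : Board n) : Board (suc (suc n)) → Set where
  lifted  : ∀ {X″} → Step bk b X X″ → SimulatedReply b X (mk ∷ bk ∷ X″)
  leavesV : ∀ w → lookup X w ≡ empty → SimulatedReply b X (mk ∷ empty ∷ (X [ w ]≔ bk))

simulatedReply : ∀ {n} b {X : Board n} {B″} → Step bk (1+ b) (mk ∷ bk ∷ X) B″ → SimulatedReply b X B″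
simulatedReply b pass                                   = lifted pass
simulatedReply b (place zero () _)
simulatedReply b (place (suc zero) () _)
simulatedReply b (place (suc (suc i)) p can)            = lifted (place i p (canUseNew-1+⁻ b can))
simulatedReply b (move zero _ () _)
simulatedReply b (move (suc zero) zero _ ())
simulatedReply b (move (suc zero) (suc zero) _ ())
simulatedReply b (move (suc zero) (suc (suc w)) _ free) = leavesV w free
simulatedReply b (move (suc (suc i)) zero _ ())
simulatedReply b (move (suc (suc i)) (suc zero) _ ())
simulatedReply b (move (suc (suc i)) (suc (suc j)) p q) = lifted (move i j p q)

data PairReply {n} (s : Tokens) (Z : Board n) : Board (suc (suc n)) → Set where
  within : ∀ {Z″} → Step bk s Z Z″ → PairReply s Z (mk ∷ mk ∷ Z″)

pairReply : ∀ {n s} {Z : Board n} {B″} → Step bk s (mk ∷ mk ∷ Z) B″ → PairReply s Z B″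
pairReply pass                                   = within pass
pairReply (place zero () _)
pairReply (place (suc zero) () _)
pairReply (place (suc (suc i)) p can)            = within (place i p can)
pairReply (move zero _ () _)
pairReply (move (suc zero) _ () _)
pairReply (move (suc (suc i)) zero _ ())
pairReply (move (suc (suc i)) (suc zero) _ ())
pairReply (move (suc (suc i)) (suc (suc j)) p q) = within (move i j p q)

data OpeningReply {n} : Board (suc (suc n)) → Set where
  onV    : OpeningReply (mk ∷ bk ∷ emptyBoard)
  passes : OpeningReply (mk ∷ empty ∷ emptyBoard)
  onOld  : ∀ i → OpeningReply (mk ∷ empty ∷ (emptyBoard [ i ]≔ bk))

openingReply : ∀ {n s} {B″ : Board (suc (suc n))} → Step bk s (mk ∷ empty ∷ emptyBoard) B″ → OpeningReply B″
openingReply pass                      = passes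
openingReply (place zero () _)
openingReply (place (suc zero) _ _)    = onV
openingReply (place (suc (suc i)) _ _) = onOld i
openingReply (move zero _ () _)
openingReply (move (suc zero) _ () _)
openingReply (move (suc (suc i)) _ p _) = ⊥-elim (≡-≢ (lookup-replicate i empty) (λ ()) p)

Clear : ∀ {n} → State (suc (suc n)) → Set
Clear (_ ∷ y ∷ _ , _) = y ≢ mk

-- While Maker holds v she gains an old vertex in every round, so those states never repeat.
Fewer : ∀ {n} → ℕ → State (suc (suc n)) → Set
Fewer m (_ ∷ y ∷ Z , _) = y ≡ mk → #mk Z < m

clear⇒fewer : ∀ {n m} {s : State (suc (suc n))} → Clear s → Fewer m s
clear⇒fewer {s = _ ∷ _ ∷ _ , _} y≢mk y≡mk = ⊥-elim (y≢mk y≡mk)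

fewer-≤ : ∀ {n m m′} {s : State (suc (suc n))} → m ≤ m′ → Fewer m s → Fewer m′ s
fewer-≤ {s = _ ∷ _ ∷ _ , _} m≤m′ fewer y≡mk = <-≤-trans (fewer y≡mk) m≤m′

fewer⇒∉ : ∀ {n m V} {Z : Board n} {p} → All (Fewer m) V → #mk Z ≡ m → (mk ∷ mk ∷ Z , p) ∉ₗ V
fewer⇒∉ fewer mk= s∈ = <-irrefl mk= (All.lookup fewer s∈ refl)

embed-clear : ∀ {n} (V : List (State n)) → All Clear (embed V)
embed-clear V = All-++⁺ (All-map⁺ (All.universal (λ _ ()) V)) ((λ ()) ∷ (λ ()) ∷ [])

vacated∉embed : ∀ {n} {V : List (State n)} {Y} → (mk ∷ empty ∷ Y , maker) ∉ₗ embed V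
vacated∉embed {V = V} s∈ with ∈-++⁻ (map embedState V) s∈
... | inj₁ s∈V               = All¬⇒¬Any (All.universal (λ _ ()) V) (Any-map⁻ s∈V)
... | inj₂ (here ())
... | inj₂ (there (here ()))
... | inj₂ (there (there ()))

module _ {n : ℕ} (k : ℕ) (H : Hypergraph n) (uni : Uniform (suc k) H) (a b : Tokens) (enough : Within a (suc k)) where

  private
    H′ = augment (suc k) H

  pairPhase : ∀ r {f V Z} → k ∸ #mk Z ≡ r → All (Fewer (#mk Z)) V →
              roomB r (spare (1+ b) (#bk Z)) ≤ #free Z → Lasts f r →
              Forces H′ (1+ a) (1+ b) f V (mk ∷ mk ∷ Z)
  pairMove  : ∀ r {f V Z} → k ∸ #mk Z ≡ suc r → All (Fewer (suc (#mk Z))) V →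
              roomM (suc r) (spare (1+ b) (#bk Z)) ≤ #free Z → Lasts f (suc r) →
              Wins H′ (1+ a) (1+ b) f V (mk ∷ mk ∷ Z)

  pairPhase zero {Z = Z} need _ _ _ = filled (fills-augment-pair H Z (m∸n≡0⇒m≤n need))
  pairPhase (suc r) {f} {V} {Z} need fewer room lasts = replies (fewer⇒∉ fewer refl) reply
    where
    reply : ∀ {B″} → Step bk (1+ b) (mk ∷ mk ∷ Z) B″ →
            (B″ , maker) ∉ₗ (mk ∷ mk ∷ Z , breaker) ∷ V ×
            Wins H′ (1+ a) (1+ b) f ((B″ , maker) ∷ (mk ∷ mk ∷ Z , breaker) ∷ V) B″
    reply st with pairReply st
    ... | within {Z″} st′ =
      (λ { (here ()) ; (there s∈) → fewer⇒∉ fewer mk= s∈ }) ,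
      pairMove r (trans (cong (k ∸_) mk=) need) fewer′ (roomB-breaker-step st′ room) lasts
      where
      mk= : #mk Z″ ≡ #mk Z
      mk= = proj₁ (step-counts breaker-maker st′)
      Z≤Z″ : #mk Z ≤ #mk Z″
      Z≤Z″ = ≤-reflexive (sym mk=)
      fewer′ : All (Fewer (suc (#mk Z″))) ((mk ∷ mk ∷ Z″ , maker) ∷ (mk ∷ mk ∷ Z , breaker) ∷ V)
      fewer′ = (λ _ → ≤-refl) ∷ (λ _ → s≤s Z≤Z″) ∷ All.map (fewer-≤ (m≤n⇒m≤1+n Z≤Z″)) fewer

  pairMove r {f} {V} {Z} need fewer room lasts
    with spend f lasts | cell-of Z empty (≤-trans (s≤s z≤n) room)
  ... | _ , t , lasts′ | i , free =
    win t (place (suc (suc i)) free can) (pairPhase r need′ fewer′ room′ lasts′)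
    where
    Z′ = Z [ i ]≔ mk
    counts = placed-counts maker-breaker Z i free
    mk= : #mk Z′ ≡ suc (#mk Z)
    mk= = proj₁ (proj₂ counts)
    can : CanUseNew (1+ a) (suc (suc (#mk Z)))
    can = canUseNew-1+ a (within⇒canUseNew a enough (s≤s (m∸n≢0⇒n<m (≡-≢ need λ ()))))
    need′ : k ∸ #mk Z′ ≡ r
    need′ = trans (cong (k ∸_) mk=) (trans (sym (pred[m∸n]≡m∸[1+n] k (#mk Z))) (cong pred need))
    fewer′ : All (Fewer (#mk Z′)) V
    fewer′ = subst (λ m → All (Fewer m) V) (sym mk=) fewer
    room′ : roomB r (spare (1+ b) (#bk Z′)) ≤ #free Z′
    room′ = s≤s⁻¹ (begin
      suc (roomB r (spare (1+ b) (#bk Z′))) ≡⟨ cong (λ m → suc (roomB r (spare (1+ b) m))) (proj₁ counts) ⟩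
      suc (roomB r (spare (1+ b) (#bk Z)))  ≤⟨ room ⟩
      #free Z                               ≡⟨ proj₂ (proj₂ counts) ⟨
      suc (#free Z′)                        ∎)
      where open ≤-Reasoning

  exhausted : ∀ {m} → ¬ CanUseNew (1+ a) (suc m) → suc k ≤ m
  exhausted cannot = ≮⇒≥ (λ m<1+k → cannot (canUseNew-1+ a (within⇒canUseNew a enough m<1+k)))

  pairEntry : ∀ {f V Y} → All Clear V → RoomB k (1+ b) Y → Lasts f (suc (k ∸ #mk Y)) →
              Wins H′ (1+ a) (1+ b) f V (mk ∷ empty ∷ Y)
  pairEntry {f} {V} {Y} clear room lasts with spend f lasts | canUseNew? (1+ a) (suc (#mk Y))
  ... | _ , t , lasts′ | yes can =
    win t (place (suc zero) refl can) (pairPhase (k ∸ #mk Y) refl (All.map clear⇒fewer clear) room lasts′)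
  -- Out of unused tokens, Maker already holds k + 1 old vertices and moves one of them to v.
  ... | _ , t , _      | no cannot with cell-of Y mk (≤-trans (s≤s z≤n) (exhausted cannot))
  ...   | i , held =
    win t (move (suc (suc i)) (suc zero) held refl)
          (filled (fills-augment-pair H (Y [ i ]≔ empty) (s≤s⁻¹ (≤-trans (exhausted cannot) (≤-reflexive removed)))))
    where
    removed : #mk Y ≡ suc (#mk (Y [ i ]≔ empty))
    removed = sym (tokensOn-[]≔ Y i empty mk held)

  pairEntry-grab : ∀ {f V₁ X w V} → Wins H a b f V₁ X → lookup X w ≡ empty → All Clear V →
                   Wins H′ (1+ a) (1+ b) f V (mk ∷ empty ∷ (X [ w ]≔ bk))
  pairEntry-grab {X = X} {w} winX free clear =
    pairEntry clear room (subst (λ m → Lasts _ (suc (k ∸ m))) (sym mk=) (wins⇒lasts uni winX))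
    where
    Y = X [ w ]≔ bk
    counts = placed-counts breaker-maker X w free
    mk= : #mk Y ≡ #mk X
    mk= = proj₁ counts
    room : RoomB k (1+ b) Y
    room = begin
      roomB (k ∸ #mk Y) (spare (1+ b) (#bk Y))
        ≡⟨ cong₂ (λ m m′ → roomB (k ∸ m) (spare (1+ b) m′)) mk= (proj₁ (proj₂ counts)) ⟩
      roomB (k ∸ #mk X) (spare (1+ b) (suc (#bk X)))
        ≡⟨ cong (roomB (k ∸ #mk X)) (spare-1+ b (#bk X)) ⟩
      roomB (k ∸ #mk X) (spare b (#bk X))
        ≤⟨ roomM⇒roomB k (#mk X) _ (≤-trans (wins⇒room uni winX) (≤-reflexive (sym (proj₂ (proj₂ counts))))) ⟩
      #free Y ∎
      where open ≤-Reasoning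

  pairEntry-pass : ∀ {f V₁ V} → Wins H a b f V₁ emptyBoard → All Clear V →
                   Wins H′ (1+ a) (1+ b) f V (mk ∷ empty ∷ emptyBoard)
  pairEntry-pass w clear = pairEntry clear room (wins⇒lasts uni w)
    where
    reserve : ∀ {m m′ e} → roomM (suc k ∸ m) (spare b m′) ≤ e → m ≡ 0 → m′ ≡ 0 →
              roomB (k ∸ m) (spare (1+ b) m′) ≤ e
    reserve room₀ refl refl = ≤-trans (roomB-reserve k b) room₀
    room : RoomB k (1+ b) (emptyBoard {n})
    room = reserve (wins⇒room uni w) (tokensOn-emptyBoard n maker-breaker) (tokensOn-emptyBoard n breaker-maker)

  simulate : ∀ {f V X} → Wins H a b f V X → Wins H′ (1+ a) (1+ b) f (embed V) (mk ∷ bk ∷ X)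
  simulate (win t st (filled fl)) = win t (lift-maker a st) (filled (fills-augment bk fl))
  simulate {V = V} (win {f′ = f′} {B′ = X′} t st (replies fresh next)) =
    win t (lift-maker a st) (replies (fresh ∘ embed-∈⁻) reply)
    where
    reply : ∀ {B″} → Step bk (1+ b) (mk ∷ bk ∷ X′) B″ →
            (B″ , maker) ∉ₗ (mk ∷ bk ∷ X′ , breaker) ∷ embed V ×
            Wins H′ (1+ a) (1+ b) f′ ((B″ , maker) ∷ (mk ∷ bk ∷ X′ , breaker) ∷ embed V) B″
    reply st′ with simulatedReply b st′
    ... | lifted st″     = proj₁ (next st″) ∘ embed-∈⁻ , simulate (proj₂ (next st″))
    ... | leavesV w free =
      (λ { (here ()) ; (there s∈) → vacated∉embed s∈ }) ,
      pairEntry-grab (proj₂ (next pass)) free ((λ ()) ∷ (λ ()) ∷ embed-clear V)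

  extend : ∀ {f₁ f₀} → f₁ ↝ f₀ → Wins H a b f₀ [ (emptyBoard , maker) ] emptyBoard →
           Wins H′ (1+ a) (1+ b) f₁ [ (emptyBoard , maker) ] emptyBoard
  extend {f₀ = f₀} t w =
    win t (place zero refl (canUseNew-1+-0 a (tokensOn-emptyBoard (suc (suc n)) maker-breaker)))
          (replies (λ { (here ()) ; (there ()) }) reply)
    where
    History = (mk ∷ empty ∷ emptyBoard , breaker) ∷ [ (emptyBoard , maker) ]
    fresh : ∀ {y Z} → (mk ∷ y ∷ Z , maker) ∉ₗ History
    fresh = λ { (here ()) ; (there (here ())) ; (there (there ())) }
    clear : ∀ {Y} → All Clear ((mk ∷ empty ∷ Y , maker) ∷ History)
    clear = (λ ()) ∷ (λ ()) ∷ (λ ()) ∷ []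
    reply : ∀ {B″} → Step bk (1+ b) (mk ∷ empty ∷ emptyBoard) B″ →
            (B″ , maker) ∉ₗ History × Wins H′ (1+ a) (1+ b) f₀ ((B″ , maker) ∷ History) B″
    reply st with openingReply st
    ... | onV     = fresh , simulate w
    ... | passes  = fresh , pairEntry-pass w clear
    ... | onOld i = fresh , pairEntry-grab w (lookup-replicate i empty) clear

extend-0 : ∀ {n} {H : Hypergraph n} {a b f₁ f₀ V} → Uniform 0 H → f₁ ↝ f₀ → Wins H a b f₀ V emptyBoard →
           Wins (augment 0 H) (1+ a) (1+ b) f₁ [ (emptyBoard , maker) ] emptyBoard
extend-0 {n} {a = a} uni t w =
  let B , fl , _ = fills-along-passes (λ _ → ⊤) (λ _ _ → tt) w tt
  in win t (place zero refl (canUseNew-1+-0 a (tokensOn-emptyBoard (suc (suc n)) maker-breaker)))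
           (filled (fills-augment {k = 0} empty (fills-0-uniform uni B emptyBoard fl)))

augment-wins : ∀ k {n} (H : Hypergraph n) → Uniform k H → ∀ a b {f₁ f₀} → f₁ ↝ f₀ →
               Wins H a b f₀ [ (emptyBoard , maker) ] emptyBoard →
               Wins (augment k H) (1+ a) (1+ b) f₁ [ (emptyBoard , maker) ] emptyBoard
augment-wins zero        H uni a b t w = extend-0 uni t w
augment-wins (suc k) {n} H uni a b t w = extend k H uni a b enough t w
  where
  enough : Within a (suc k)
  enough = wins⇒within uni w (within-0 a (tokensOn-emptyBoard n maker-breaker))

proposition2p5 : (k n : ℕ) (H : Hypergraph n) → Uniform k H →
    Σ (Hypergraph (suc (suc n))) λ H' →
      Uniform (suc k) H' ×
      ((a b : ℕ) →
        MakerWinsGame H (fin (suc a)) (fin (suc b)) ⇔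
        MakerWinsGame H' (fin (suc (suc a))) (fin (suc (suc b)))) ×
      ((t : ℕ) → FastWin H (suc t) ⇔ FastWin H' (suc (suc t)))
proposition2p5 k n H uni = augment k H , augment-uniform uni , games , fast
  where
  open Equivalence
  games : ∀ a b → MakerWinsGame H (fin (suc a)) (fin (suc b)) ⇔
                  MakerWinsGame (augment k H) (fin (suc (suc a))) (fin (suc (suc b)))
  games a b = mk⇔
    (from makerWins⇔wins ∘ augment-wins k H uni _ _ tick∞ ∘ to makerWins⇔wins)
    (from makerWins⇔wins ∘ augment-wins⁻ k H _ _ tick∞ tick∞ ∘ to makerWins⇔wins)
  fast : ∀ t → FastWin H (suc t) ⇔ FastWin (augment k H) (suc (suc t))
  fast t = mk⇔
    (from (winWithin⇔wins (suc (suc t))) ∘ augment-wins k H uni _ _ tick ∘ to (winWithin⇔wins (suc t)))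
    (from (winWithin⇔wins (suc t)) ∘ augment-wins⁻ k H _ _ tick tick ∘ to (winWithin⇔wins (suc (suc t))))
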